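{- $$\sum_{u\in V}\sum_{v\in N_u^+}d_{uv}\le 3\cdot\mathsf{OPT}(1).$$
   Context: $G=(V,E)$ is a complete graph with every edge labeled positive or negative; every vertex has a positive self-loop. $N_u^+$ is the set of $v$ with $(u,v)$ positive (so $u\in N_u^+$). The correlation metric is $d_{uv}=1-\frac{|N_u^+\cap N_v^+|}{|N_u^+\cup N_v^+|}$. A clustering is a partition of $V$; a positive edge is a disagreement if its endpoints are in different clusters, a negative edge if in the same cluster; $y_{\mathcal{C}}(u)$ counts disagreements at $u$; $\mathsf{OPT}(1)=\min_{\mathcal{C}}\sum_u y_{\mathcal{C}}(u)$. -}

module Defs where

open import Data.Bool using (Bool; true; false; if_then_else_; _∧_; _∨_; not)
open import Data.Nat using (ℕ; zero; suc)
import Data.Nat as ℕ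
open import Data.Fin using (Fin)
import Data.Fin as Fin
open import Data.List using (List; foldr; map)
open import Data.Fin.Base using ()
open import Data.List using (allFin)
open import Data.Integer using (+_)
open import Data.Rational using (ℚ; 0ℚ; 1ℚ; _/_; _+_; _-_)
open import Relation.Nullary.Decidable using (⌊_⌋)
open import Relation.Binary.PropositionalEquality using (_≡_)

-- A complete graph on vertex set Fin n, every edge labelled positive
-- (true) or negative (false); labels are symmetric; every vertex has a
-- positive self-loop.
record SignedGraph (n : ℕ) : Set where
  field
    pos     : Fin n → Fin n → Bool
    pos-sym : ∀ u v → pos u v ≡ pos v u
    pos-refl : ∀ u → pos u u ≡ true
open SignedGraph public

Σℕ : ∀ {n} → (Fin n → ℕ) → ℕ
Σℕ {n} f = foldr ℕ._+_ 0 (map f (allFin n))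

Σℚ : ∀ {n} → (Fin n → ℚ) → ℚ
Σℚ {n} f = foldr _+_ 0ℚ (map f (allFin n))

count : ∀ {n} → (Fin n → Bool) → ℕ
count P = Σℕ (λ w → if P w then 1 else 0)

-- a / b as a rational; b = 0 never occurs below (the union contains u)
frac : ℕ → ℕ → ℚ
frac a zero    = 0ℚ
frac a (suc b) = (+ a) / suc b

dist : ∀ {n} → SignedGraph n → Fin n → Fin n → ℚ
dist G u v =
  1ℚ - frac (count (λ w → pos G u w ∧ pos G v w))
            (count (λ w → pos G u w ∨ pos G v w))

sumPosDist : ∀ {n} → SignedGraph n → ℚ
sumPosDist G = Σℚ (λ u → Σℚ (λ v → if pos G u v then dist G u v else 0ℚ))

-- A clustering (partition of V) given by a cluster label for each vertex;
-- every partition of Fin n arises this way (labels in Fin n suffice).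
Clustering : ℕ → Set
Clustering n = Fin n → Fin n

sameCluster : ∀ {n} → Clustering n → Fin n → Fin n → Bool
sameCluster C u v = ⌊ C u Fin.≟ C v ⌋

disagreements : ∀ {n} → SignedGraph n → Clustering n → Fin n → ℕ
disagreements G C u =
  count (λ v → (pos G u v ∧ not (sameCluster C u v))
             ∨ (not (pos G u v) ∧ sameCluster C u v))

-- Σ_u y_C(u)  (the objective whose minimum over C is OPT(1))
cost1 : ∀ {n} → SignedGraph n → Clustering n → ℕ
cost1 G C = Σℕ (disagreements G C)

{-# OPTIONS --safe #-}
module Submission where

open import Defs
open import Data.Nat using (ℕ)
open import Data.Integer using (+_)
open import Data.Rational using (ℚ; _≤_; _*_; _/_)

open import Algebra.Bundles using (CommutativeRing)
open import Data.Bool using (Bool; true; false; if_then_else_; _∧_; _∨_; not; _xor_; T)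
open import Data.Bool.Properties using (T-∨)
open import Data.Empty using (⊥-elim)
open import Data.Fin as Fin using (Fin)
open import Data.Integer as ℤ using (ℤ)
import Data.Integer.Properties as ℤP
open import Data.Integer.Tactic.RingSolver using (solve-∀)
import Data.List as List
import Data.List.Properties as ListP
open import Data.Nat as ℕ using (zero; suc; z≤n; s≤s; NonZero)
import Data.Nat.Properties as ℕP
open import Data.Rational using (_+_; _-_; 0ℚ; 1ℚ; toℚᵘ; Positive; nonNegative)
import Data.Rational.Properties as ℚP
open import Data.Rational.Solver using (module +-*-Solver)
import Data.Rational.Unnormalised as ℚᵘ
import Data.Rational.Unnormalised.Properties as ℚᵘP
open import Data.Sum using (inj₁; inj₂)
open import Data.Unit using (tt)
open import Data.Vec.Functional as Vector using (Vector)
open import Function using (_∘_; id)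
open import Function.Bundles using (Equivalence)
open import Relation.Binary.PropositionalEquality
open import Relation.Nullary.Decidable using (⌊_⌋; yes; no)

open import Algebra.Properties.AbelianGroup ℚP.+-0-abelianGroup using (xyx⁻¹≈y)
open +-*-Solver using (_:=_; _:+_; _:*_; con)

-- For a positive edge uv inside a cluster, every w ∈ N_u⁺ Δ N_v⁺ is a disagreement at u or at v,
-- so d_uv = |N_u⁺ Δ N_v⁺| / |N_u⁺ ∪ N_v⁺| ≤ y(u)/|N_u⁺| + y(v)/|N_v⁺|; a positive edge cut by the
-- clustering has d_uv ≤ 1 and is itself a disagreement. Summing over the pairs (u, v) with v ∈ N_u⁺,
-- the cut edges contribute at most Σ_u y(u), and each of the two ratio terms contributes exactly
-- Σ_u y(u), since u has |N_u⁺| positive neighbours.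

foldr-tabulate : ∀ {A B : Set} (c : A → B → B) (e : B) {n} (f : Vector A n) →
  List.foldr c e (List.tabulate f) ≡ Vector.foldr c e f
foldr-tabulate c e {zero}  f = refl
foldr-tabulate c e {suc n} f = cong (c (f Fin.zero)) (foldr-tabulate c e (f ∘ Fin.suc))

foldr-map-allFin : ∀ {A B : Set} (c : A → B → B) (e : B) {n} (f : Vector A n) →
  List.foldr c e (List.map f (List.allFin n)) ≡ Vector.foldr c e f
foldr-map-allFin c e f = trans (cong (List.foldr c e) (ListP.map-tabulate id f)) (foldr-tabulate c e f)

module ℕΣ where
  open import Algebra.Properties.Semiring.Sum ℕP.+-*-semiring public

  sum-mono-≤ : ∀ {n} {f g : Vector ℕ n} → (∀ i → f i ℕ.≤ g i) → sum f ℕ.≤ sum g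
  sum-mono-≤ {zero}  f≤g = z≤n
  sum-mono-≤ {suc n} f≤g = ℕP.+-mono-≤ (f≤g _) (sum-mono-≤ (f≤g ∘ Fin.suc))

module ℚΣ where
  open import Algebra.Properties.Semiring.Sum (CommutativeRing.semiring ℚP.+-*-commutativeRing) public

  sum-mono-≤ : ∀ {n} {f g : Vector ℚ n} → (∀ i → f i ≤ g i) → sum f ≤ sum g
  sum-mono-≤ {zero}  f≤g = ℚP.≤-refl
  sum-mono-≤ {suc n} f≤g = ℚP.+-mono-≤ (f≤g _) (sum-mono-≤ (f≤g ∘ Fin.suc))

  ∑∑-distrib-+ : ∀ {m n} (f g : Fin m → Fin n → ℚ) →
    sum (λ u → sum (λ v → f u v + g u v))
      ≡ sum (λ u → sum (f u)) + sum (λ u → sum (g u))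
  ∑∑-distrib-+ f g = trans (sum-cong-≗ (λ u → ∑-distrib-+ (f u) (g u)))
                           (∑-distrib-+ (λ u → sum (f u)) (λ u → sum (g u)))

Σℕ≡sum : ∀ {n} (f : Vector ℕ n) → Σℕ f ≡ ℕΣ.sum f
Σℕ≡sum f = foldr-map-allFin ℕ._+_ 0 f

Σℚ≡sum : ∀ {n} (f : Vector ℚ n) → Σℚ f ≡ ℚΣ.sum f
Σℚ≡sum f = foldr-map-allFin _+_ 0ℚ f

fromℕ : ℕ → ℚ
fromℕ n = + n / 1

-- _/_ normalises through gcd, which does not compute on variables, so identities
-- between such rationals are checked on their unnormalised representatives.
toℚᵘ-/ : ∀ m d → toℚᵘ (+ m / suc d) ℚᵘ.≃ ℚᵘ.mkℚᵘ (+ m) d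
toℚᵘ-/ m d = ℚP.toℚᵘ-fromℚᵘ (ℚᵘ.mkℚᵘ (+ m) d)

fromℕ-+ : ∀ m n → fromℕ (m ℕ.+ n) ≡ fromℕ m + fromℕ n
fromℕ-+ m n = ℚP.toℚᵘ-injective (begin
  toℚᵘ (fromℕ (m ℕ.+ n))                          ≈⟨ toℚᵘ-/ (m ℕ.+ n) 0 ⟩
  ℚᵘ.mkℚᵘ (+ (m ℕ.+ n)) 0                          ≈⟨ ℚᵘ.*≡* (trans (cong (ℤ._* + 1) (ℤP.pos-+ m n)) (cross (+ m) (+ n))) ⟩
  ℚᵘ.mkℚᵘ (+ m) 0 ℚᵘ.+ ℚᵘ.mkℚᵘ (+ n) 0             ≈⟨ ℚᵘP.+-cong (toℚᵘ-/ m 0) (toℚᵘ-/ n 0) ⟨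
  toℚᵘ (fromℕ m) ℚᵘ.+ toℚᵘ (fromℕ n)               ≈⟨ ℚP.toℚᵘ-homo-+ (fromℕ m) (fromℕ n) ⟨
  toℚᵘ (fromℕ m + fromℕ n)                         ∎)
  where
  open import Relation.Binary.Reasoning.Setoid ℚᵘP.≃-setoid
  cross : ∀ (x y : ℤ) → (x ℤ.+ y) ℤ.* + 1 ≡ (x ℤ.* + 1 ℤ.+ y ℤ.* + 1) ℤ.* + 1
  cross = solve-∀

frac-*-fromℕ : ∀ m d .{{_ : NonZero d}} → frac m d * fromℕ d ≡ fromℕ m
frac-*-fromℕ m (suc d) = ℚP.toℚᵘ-injective (begin
  toℚᵘ (frac m (suc d) * fromℕ (suc d))               ≈⟨ ℚP.toℚᵘ-homo-* (frac m (suc d)) (fromℕ (suc d)) ⟩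
  toℚᵘ (frac m (suc d)) ℚᵘ.* toℚᵘ (fromℕ (suc d))    ≈⟨ ℚᵘP.*-cong (toℚᵘ-/ m d) (toℚᵘ-/ (suc d) 0) ⟩
  ℚᵘ.mkℚᵘ (+ m) d ℚᵘ.* ℚᵘ.mkℚᵘ (+ suc d) 0            ≈⟨ ℚᵘ.*≡* (cross (+ m) (+ suc d)) ⟩
  ℚᵘ.mkℚᵘ (+ m) 0                                    ≈⟨ toℚᵘ-/ m 0 ⟨
  toℚᵘ (fromℕ m)                                     ∎)
  where
  open import Relation.Binary.Reasoning.Setoid ℚᵘP.≃-setoid
  cross : ∀ (x y : ℤ) → (x ℤ.* y) ℤ.* + 1 ≡ x ℤ.* (y ℤ.* + 1)
  cross = solve-∀

fromℕ-nonNeg : ∀ n → 0ℚ ≤ fromℕ n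
fromℕ-nonNeg n = ℚP.nonNegative⁻¹ (fromℕ n) {{ℚP.normalize-nonNeg n 1}}

instance
  fromℕ-pos : ∀ {d} .{{_ : NonZero d}} → Positive (fromℕ d)
  fromℕ-pos {suc d} = ℚP.normalize-pos (suc d) 1

fromℕ-mono-≤ : ∀ {m n} → m ℕ.≤ n → fromℕ m ≤ fromℕ n
fromℕ-mono-≤ {m} {n} m≤n = begin
  fromℕ m                   ≡⟨ ℚP.+-identityʳ (fromℕ m) ⟨
  fromℕ m + 0ℚ              ≤⟨ ℚP.+-monoʳ-≤ (fromℕ m) (fromℕ-nonNeg (n ℕ.∸ m)) ⟩
  fromℕ m + fromℕ (n ℕ.∸ m) ≡⟨ fromℕ-+ m (n ℕ.∸ m) ⟨
  fromℕ (m ℕ.+ (n ℕ.∸ m))   ≡⟨ cong fromℕ (ℕP.m+[n∸m]≡n m≤n) ⟩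
  fromℕ n                   ∎
  where open ℚP.≤-Reasoning

sum-fromℕ : ∀ {n} (f : Vector ℕ n) → ℚΣ.sum (fromℕ ∘ f) ≡ fromℕ (ℕΣ.sum f)
sum-fromℕ {zero}  f = refl
sum-fromℕ {suc n} f = trans (cong (_+_ (fromℕ (f Fin.zero))) (sum-fromℕ (f ∘ Fin.suc)))
                            (sym (fromℕ-+ (f Fin.zero) (ℕΣ.sum (f ∘ Fin.suc))))

frac-nonNeg : ∀ m d → 0ℚ ≤ frac m d
frac-nonNeg m zero    = ℚP.≤-refl
frac-nonNeg m (suc d) = ℚP.nonNegative⁻¹ (frac m (suc d)) {{ℚP.normalize-nonNeg m (suc d)}}

module _ {d : ℕ} .{{_ : NonZero d}} where

  *-fromℕ-cancelʳ : ∀ {p q} → p * fromℕ d ≡ q * fromℕ d → p ≡ q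
  *-fromℕ-cancelʳ eq = ℚP.≤-antisym (ℚP.*-cancelʳ-≤-pos (fromℕ d) (ℚP.≤-reflexive eq))
                                     (ℚP.*-cancelʳ-≤-pos (fromℕ d) (ℚP.≤-reflexive (sym eq)))

  frac-self : frac d d ≡ 1ℚ
  frac-self = *-fromℕ-cancelʳ (trans (frac-*-fromℕ d d) (sym (ℚP.*-identityˡ (fromℕ d))))

  frac-+ : ∀ m n → frac (m ℕ.+ n) d ≡ frac m d + frac n d
  frac-+ m n = *-fromℕ-cancelʳ (begin
    frac (m ℕ.+ n) d * fromℕ d                  ≡⟨ frac-*-fromℕ (m ℕ.+ n) d ⟩
    fromℕ (m ℕ.+ n)                             ≡⟨ fromℕ-+ m n ⟩
    fromℕ m + fromℕ n                           ≡⟨ cong₂ _+_ (frac-*-fromℕ m d) (frac-*-fromℕ n d) ⟨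
    frac m d * fromℕ d + frac n d * fromℕ d     ≡⟨ ℚP.*-distribʳ-+ (fromℕ d) (frac m d) (frac n d) ⟨
    (frac m d + frac n d) * fromℕ d             ∎)
    where open ≡-Reasoning

  frac-mono-≤ : ∀ {m n} → m ℕ.≤ n → frac m d ≤ frac n d
  frac-mono-≤ {m} {n} m≤n = ℚP.*-cancelʳ-≤-pos (fromℕ d) (begin
    frac m d * fromℕ d  ≡⟨ frac-*-fromℕ m d ⟩
    fromℕ m             ≤⟨ fromℕ-mono-≤ m≤n ⟩
    fromℕ n             ≡⟨ frac-*-fromℕ n d ⟨
    frac n d * fromℕ d  ∎)
    where open ℚP.≤-Reasoning

  one-minus-frac : ∀ m n → d ≡ m ℕ.+ n → 1ℚ - frac m d ≡ frac n d
  one-minus-frac m n d≡m+n = begin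
    1ℚ - frac m d                     ≡⟨ cong (_- frac m d) frac-self ⟨
    frac d d - frac m d               ≡⟨ cong (λ k → frac k d - frac m d) d≡m+n ⟩
    frac (m ℕ.+ n) d - frac m d       ≡⟨ cong (_- frac m d) (frac-+ m n) ⟩
    frac m d + frac n d - frac m d    ≡⟨ xyx⁻¹≈y (frac m d) (frac n d) ⟩
    frac n d                          ∎
    where open ≡-Reasoning

frac-antimono-≤ : ∀ m {d e} .{{_ : NonZero d}} .{{_ : NonZero e}} → d ℕ.≤ e → frac m e ≤ frac m d
frac-antimono-≤ m {d} {e} d≤e = ℚP.*-cancelʳ-≤-pos (fromℕ e) (begin
  frac m e * fromℕ e   ≡⟨ frac-*-fromℕ m e ⟩
  fromℕ m              ≡⟨ frac-*-fromℕ m d ⟨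
  frac m d * fromℕ d   ≤⟨ ℚP.*-monoˡ-≤-nonNeg (frac m d) {{nonNegative (frac-nonNeg m d)}} (fromℕ-mono-≤ d≤e) ⟩
  frac m d * fromℕ e   ∎)
  where open ℚP.≤-Reasoning

𝟙 : Bool → ℕ
𝟙 b = if b then 1 else 0

𝟙-mono-≤ : ∀ {a b} → (T a → T b) → 𝟙 a ℕ.≤ 𝟙 b
𝟙-mono-≤ {false}         _   = z≤n
𝟙-mono-≤ {true}  {true}  _   = ℕP.≤-refl
𝟙-mono-≤ {true}  {false} a⇒b = ⊥-elim (a⇒b tt)

𝟙-∨-≤ : ∀ a b → 𝟙 (a ∨ b) ℕ.≤ 𝟙 a ℕ.+ 𝟙 b
𝟙-∨-≤ true  b = s≤s z≤n
𝟙-∨-≤ false b = ℕP.≤-refl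

𝟙-∨ : ∀ a b → 𝟙 (a ∨ b) ≡ 𝟙 (a ∧ b) ℕ.+ 𝟙 (a xor b)
𝟙-∨ true  true  = refl
𝟙-∨ true  false = refl
𝟙-∨ false b     = refl

count≡sum : ∀ {n} (P : Fin n → Bool) → count P ≡ ℕΣ.sum (𝟙 ∘ P)
count≡sum P = Σℕ≡sum (𝟙 ∘ P)

count-mono-≤ : ∀ {n} (P Q : Fin n → Bool) → (∀ w → T (P w) → T (Q w)) → count P ℕ.≤ count Q
count-mono-≤ P Q P⇒Q = begin
  count P            ≡⟨ count≡sum P ⟩
  ℕΣ.sum (𝟙 ∘ P)     ≤⟨ ℕΣ.sum-mono-≤ (λ w → 𝟙-mono-≤ (P⇒Q w)) ⟩
  ℕΣ.sum (𝟙 ∘ Q)     ≡⟨ count≡sum Q ⟨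
  count Q            ∎
  where open ℕP.≤-Reasoning

count-∨-≤ : ∀ {n} (P Q : Fin n → Bool) → count (λ w → P w ∨ Q w) ℕ.≤ count P ℕ.+ count Q
count-∨-≤ P Q = begin
  count (λ w → P w ∨ Q w)                 ≡⟨ count≡sum (λ w → P w ∨ Q w) ⟩
  ℕΣ.sum (λ w → 𝟙 (P w ∨ Q w))            ≤⟨ ℕΣ.sum-mono-≤ (λ w → 𝟙-∨-≤ (P w) (Q w)) ⟩
  ℕΣ.sum (λ w → 𝟙 (P w) ℕ.+ 𝟙 (Q w))      ≡⟨ ℕΣ.∑-distrib-+ (𝟙 ∘ P) (𝟙 ∘ Q) ⟩
  ℕΣ.sum (𝟙 ∘ P) ℕ.+ ℕΣ.sum (𝟙 ∘ Q)       ≡⟨ cong₂ ℕ._+_ (count≡sum P) (count≡sum Q) ⟨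
  count P ℕ.+ count Q                     ∎
  where open ℕP.≤-Reasoning

count-∨ : ∀ {n} (P Q : Fin n → Bool) →
  count (λ w → P w ∨ Q w) ≡ count (λ w → P w ∧ Q w) ℕ.+ count (λ w → P w xor Q w)
count-∨ P Q = begin
  count (λ w → P w ∨ Q w)                                    ≡⟨ count≡sum (λ w → P w ∨ Q w) ⟩
  ℕΣ.sum (λ w → 𝟙 (P w ∨ Q w))                               ≡⟨ ℕΣ.sum-cong-≗ (λ w → 𝟙-∨ (P w) (Q w)) ⟩
  ℕΣ.sum (λ w → 𝟙 (P w ∧ Q w) ℕ.+ 𝟙 (P w xor Q w))           ≡⟨ ℕΣ.∑-distrib-+ (λ w → 𝟙 (P w ∧ Q w)) (λ w → 𝟙 (P w xor Q w)) ⟩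
  ℕΣ.sum (λ w → 𝟙 (P w ∧ Q w)) ℕ.+ ℕΣ.sum (λ w → 𝟙 (P w xor Q w))
    ≡⟨ cong₂ ℕ._+_ (count≡sum (λ w → P w ∧ Q w)) (count≡sum (λ w → P w xor Q w)) ⟨
  count (λ w → P w ∧ Q w) ℕ.+ count (λ w → P w xor Q w)      ∎
  where open ≡-Reasoning

count≤count-∨ˡ : ∀ {n} (P Q : Fin n → Bool) → count P ℕ.≤ count (λ w → P w ∨ Q w)
count≤count-∨ˡ P Q = count-mono-≤ P (λ w → P w ∨ Q w) (λ w → Equivalence.from T-∨ ∘ inj₁)

count≤count-∨ʳ : ∀ {n} (P Q : Fin n → Bool) → count Q ℕ.≤ count (λ w → P w ∨ Q w)
count≤count-∨ʳ P Q = count-mono-≤ Q (λ w → P w ∨ Q w) (λ w → Equivalence.from T-∨ ∘ inj₂)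

𝟙≤count : ∀ {n} {P : Fin n → Bool} w → 𝟙 (P w) ℕ.≤ count P
𝟙≤count {suc n} {P} w = begin
  𝟙 (P w)                                             ≤⟨ ℕP.m≤m+n (𝟙 (P w)) _ ⟩
  𝟙 (P w) ℕ.+ ℕΣ.sum (Vector.removeAt (𝟙 ∘ P) w)      ≡⟨ ℕΣ.sum-remove (𝟙 ∘ P) ⟨
  ℕΣ.sum (𝟙 ∘ P)                                      ≡⟨ count≡sum P ⟨
  count P                                             ∎
  where open ℕP.≤-Reasoning

count-nonZero : ∀ {n} {P : Fin n → Bool} w → T (P w) → NonZero (count P)
count-nonZero w Pw = ℕ.>-nonZero (ℕP.≤-trans (𝟙-mono-≤ (λ _ → Pw)) (𝟙≤count w))

sum-if : ∀ {n} (P : Fin n → Bool) q → ℚΣ.sum (λ v → if P v then q else 0ℚ) ≡ q * fromℕ (count P)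
sum-if P q = begin
  ℚΣ.sum (λ v → if P v then q else 0ℚ)   ≡⟨ ℚΣ.sum-cong-≗ (λ v → if-as-* (P v)) ⟩
  ℚΣ.sum (λ v → q * fromℕ (𝟙 (P v)))     ≡⟨ ℚΣ.*-distribˡ-sum q (fromℕ ∘ 𝟙 ∘ P) ⟨
  q * ℚΣ.sum (fromℕ ∘ 𝟙 ∘ P)             ≡⟨ cong (q *_) (sum-fromℕ (𝟙 ∘ P)) ⟩
  q * fromℕ (ℕΣ.sum (𝟙 ∘ P))             ≡⟨ cong (λ k → q * fromℕ k) (count≡sum P) ⟨
  q * fromℕ (count P)                    ∎
  where
  open ≡-Reasoning
  if-as-* : ∀ b → (if b then q else 0ℚ) ≡ q * fromℕ (𝟙 b)
  if-as-* true  = sym (ℚP.*-identityʳ q)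
  if-as-* false = sym (ℚP.*-zeroʳ q)

mismatch : Bool → Bool → Bool
mismatch a s = (a ∧ not s) ∨ (not a ∧ s)

xor-triangle : ∀ a b {s t} → s ≡ t → T (a xor b) → T (mismatch a s ∨ mismatch b t)
xor-triangle true  false {true}  refl _ = tt
xor-triangle true  false {false} refl _ = tt
xor-triangle false true  {true}  refl _ = tt
xor-triangle false true  {false} refl _ = tt

module _ {n : ℕ} (G : SignedGraph n) where

  deg : Fin n → ℕ
  deg u = count (pos G u)

  deg-nonZero : ∀ u → NonZero (deg u)
  deg-nonZero u = count-nonZero u (subst T (sym (pos-refl G u)) tt)

  posDist : Fin n → Fin n → ℚ
  posDist u v = if pos G u v then dist G u v else 0ℚ

  module _ (C : Clustering n) where

    rate : Fin n → ℚ
    rate u = frac (disagreements G C u) (deg u)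

    rate-nonNeg : ∀ u → 0ℚ ≤ rate u
    rate-nonNeg u = frac-nonNeg (disagreements G C u) (deg u)

    rateˡ rateʳ : Fin n → Fin n → ℚ
    rateˡ u v = if pos G u v then rate u else 0ℚ
    rateʳ u v = if pos G u v then rate v else 0ℚ

    disagrees : Fin n → Fin n → Bool
    disagrees u w = mismatch (pos G u w) (sameCluster C u w)

    symDiff≤disagreements : ∀ {u v} → C u ≡ C v →
      count (λ w → pos G u w xor pos G v w) ℕ.≤ disagreements G C u ℕ.+ disagreements G C v
    symDiff≤disagreements {u} {v} Cu≡Cv = begin
      count (λ w → pos G u w xor pos G v w)
        ≤⟨ count-mono-≤ (λ w → pos G u w xor pos G v w) (λ w → disagrees u w ∨ disagrees v w)
             (λ w → xor-triangle (pos G u w) (pos G v w) (cong (λ c → ⌊ c Fin.≟ C w ⌋) Cu≡Cv)) ⟩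
      count (λ w → disagrees u w ∨ disagrees v w)
        ≤⟨ count-∨-≤ (disagrees u) (disagrees v) ⟩
      disagreements G C u ℕ.+ disagreements G C v ∎
      where open ℕP.≤-Reasoning

    dist≤rate+rate : ∀ {u v} → C u ≡ C v → dist G u v ≤ rate u + rate v
    dist≤rate+rate {u} {v} Cu≡Cv = begin
      dist G u v              ≡⟨ one-minus-frac ∩uv Δuv (count-∨ (pos G u) (pos G v)) ⟩
      frac Δuv ∪uv            ≤⟨ frac-mono-≤ (symDiff≤disagreements Cu≡Cv) ⟩
      frac (yu ℕ.+ yv) ∪uv    ≡⟨ frac-+ yu yv ⟩
      frac yu ∪uv + frac yv ∪uv
        ≤⟨ ℚP.+-mono-≤ (frac-antimono-≤ yu {{deg-nonZero u}} degu≤∪uv)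
                       (frac-antimono-≤ yv {{deg-nonZero v}} degv≤∪uv) ⟩
      rate u + rate v       ∎
      where
      open ℚP.≤-Reasoning
      yu = disagreements G C u
      yv = disagreements G C v
      ∪uv = count (λ w → pos G u w ∨ pos G v w)
      ∩uv = count (λ w → pos G u w ∧ pos G v w)
      Δuv = count (λ w → pos G u w xor pos G v w)
      degu≤∪uv : deg u ℕ.≤ ∪uv
      degu≤∪uv = count≤count-∨ˡ (pos G u) (pos G v)
      degv≤∪uv : deg v ℕ.≤ ∪uv
      degv≤∪uv = count≤count-∨ʳ (pos G u) (pos G v)
      instance
        ∪uv-nonZero : NonZero ∪uv
        ∪uv-nonZero = ℕ.>-nonZero (ℕP.<-≤-trans (ℕ.>-nonZero⁻¹ (deg u) {{deg-nonZero u}}) degu≤∪uv)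

    dist≤1 : ∀ u v → dist G u v ≤ 1ℚ
    dist≤1 u v = ℚP.+-monoʳ-≤ 1ℚ (ℚP.neg-antimono-≤ (frac-nonNeg ∩uv ∪uv))
      where
      ∩uv = count (λ w → pos G u w ∧ pos G v w)
      ∪uv = count (λ w → pos G u w ∨ pos G v w)

    cut : Fin n → Fin n → Bool
    cut u v = pos G u v ∧ not (sameCluster C u v)

    posDist≤ : ∀ u v → posDist u v ≤ fromℕ (𝟙 (cut u v)) + rateˡ u v + rateʳ u v
    posDist≤ u v with pos G u v | C u Fin.≟ C v
    ... | false | _         = ℚP.≤-refl
    ... | true  | yes Cu≡Cv =
      ℚP.≤-trans (dist≤rate+rate Cu≡Cv)
                 (ℚP.≤-reflexive (cong (_+ rate v) (sym (ℚP.+-identityˡ (rate u)))))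
    ... | true  | no _      =
      ℚP.≤-trans (dist≤1 u v) (ℚP.+-mono-≤ (ℚP.+-monoʳ-≤ 1ℚ (rate-nonNeg u)) (rate-nonNeg v))

    ∑∑cut≤cost : ℚΣ.sum (λ u → ℚΣ.sum (λ v → fromℕ (𝟙 (cut u v)))) ≤ fromℕ (cost1 G C)
    ∑∑cut≤cost = begin
      ℚΣ.sum (λ u → ℚΣ.sum (λ v → fromℕ (𝟙 (cut u v))))
        ≡⟨ ℚΣ.sum-cong-≗ (λ u → sum-fromℕ (𝟙 ∘ cut u)) ⟩
      ℚΣ.sum (λ u → fromℕ (ℕΣ.sum (𝟙 ∘ cut u)))
        ≡⟨ sum-fromℕ (λ u → ℕΣ.sum (𝟙 ∘ cut u)) ⟩
      fromℕ (ℕΣ.sum (λ u → ℕΣ.sum (𝟙 ∘ cut u)))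
        ≤⟨ fromℕ-mono-≤ (ℕΣ.sum-mono-≤ cut≤disagreements) ⟩
      fromℕ (ℕΣ.sum (disagreements G C))
        ≡⟨ cong fromℕ (Σℕ≡sum (disagreements G C)) ⟨
      fromℕ (cost1 G C) ∎
      where
      open ℚP.≤-Reasoning
      cut≤disagreements : ∀ u → ℕΣ.sum (𝟙 ∘ cut u) ℕ.≤ disagreements G C u
      cut≤disagreements u = ℕP.≤-trans (ℕP.≤-reflexive (sym (count≡sum (cut u))))
                                       (count≤count-∨ˡ (cut u) (λ w → not (pos G u w) ∧ sameCluster C u w))

    ∑∑rateˡ≡cost : ℚΣ.sum (λ u → ℚΣ.sum (rateˡ u)) ≡ fromℕ (cost1 G C)
    ∑∑rateˡ≡cost = begin
      ℚΣ.sum (λ u → ℚΣ.sum (λ v → if pos G u v then rate u else 0ℚ))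
        ≡⟨ ℚΣ.sum-cong-≗ (λ u → sum-if (pos G u) (rate u)) ⟩
      ℚΣ.sum (λ u → rate u * fromℕ (deg u))
        ≡⟨ ℚΣ.sum-cong-≗ (λ u → frac-*-fromℕ (disagreements G C u) (deg u) {{deg-nonZero u}}) ⟩
      ℚΣ.sum (λ u → fromℕ (disagreements G C u))
        ≡⟨ sum-fromℕ (disagreements G C) ⟩
      fromℕ (ℕΣ.sum (disagreements G C))
        ≡⟨ cong fromℕ (Σℕ≡sum (disagreements G C)) ⟨
      fromℕ (cost1 G C) ∎
      where open ≡-Reasoning

    ∑∑rateʳ≡cost : ℚΣ.sum (λ u → ℚΣ.sum (rateʳ u)) ≡ fromℕ (cost1 G C)
    ∑∑rateʳ≡cost = begin
      ℚΣ.sum (λ u → ℚΣ.sum (λ v → if pos G u v then rate v else 0ℚ))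
        ≡⟨ ℚΣ.∑-comm (λ u v → if pos G u v then rate v else 0ℚ) ⟩
      ℚΣ.sum (λ v → ℚΣ.sum (λ u → if pos G u v then rate v else 0ℚ))
        ≡⟨ ℚΣ.sum-cong-≗ (λ v → ℚΣ.sum-cong-≗ (λ u → cong (λ b → if b then rate v else 0ℚ) (pos-sym G u v))) ⟩
      ℚΣ.sum (λ v → ℚΣ.sum (λ u → if pos G v u then rate v else 0ℚ))
        ≡⟨ ∑∑rateˡ≡cost ⟩
      fromℕ (cost1 G C) ∎
      where open ≡-Reasoning

  sumPosDist≡∑∑ : sumPosDist G ≡ ℚΣ.sum (λ u → ℚΣ.sum (posDist u))
  sumPosDist≡∑∑ = trans (Σℚ≡sum (λ u → Σℚ (posDist u))) (ℚΣ.sum-cong-≗ (λ u → Σℚ≡sum (posDist u)))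

claim1 : ∀ (n : ℕ) (G : SignedGraph n) (C : Clustering n) →
    sumPosDist G ≤ (+ 3 / 1) * ((+ cost1 G C) / 1)
claim1 n G C = begin
  sumPosDist G
    ≡⟨ sumPosDist≡∑∑ G ⟩
  ℚΣ.sum (λ u → ℚΣ.sum (posDist G u))
    ≤⟨ ℚΣ.sum-mono-≤ (λ u → ℚΣ.sum-mono-≤ (posDist≤ G C u)) ⟩
  ℚΣ.sum (λ u → ℚΣ.sum (λ v → fromℕ (𝟙 (cut G C u v)) + rateˡ G C u v + rateʳ G C u v))
    ≡⟨ trans (ℚΣ.∑∑-distrib-+ _ (rateʳ G C))
             (cong (_+ ℚΣ.sum (λ u → ℚΣ.sum (rateʳ G C u))) (ℚΣ.∑∑-distrib-+ _ (rateˡ G C))) ⟩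
  ℚΣ.sum (λ u → ℚΣ.sum (λ v → fromℕ (𝟙 (cut G C u v))))
    + ℚΣ.sum (λ u → ℚΣ.sum (rateˡ G C u)) + ℚΣ.sum (λ u → ℚΣ.sum (rateʳ G C u))
    ≤⟨ ℚP.+-mono-≤ (ℚP.+-mono-≤ (∑∑cut≤cost G C) (ℚP.≤-reflexive (∑∑rateˡ≡cost G C)))
                   (ℚP.≤-reflexive (∑∑rateʳ≡cost G C)) ⟩
  cost + cost + cost
    ≡⟨ +-*-Solver.solve 1 (λ x → x :+ x :+ x := con (+ 3 / 1) :* x) refl cost ⟩
  (+ 3 / 1) * cost ∎
  where
  open ℚP.≤-Reasoning
  cost = fromℕ (cost1 G C)
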